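{- Let $G=(g_0,\dots,g_k)$ be a compound sequence. Then $G=G(A,B)$ for a suitable pair of $k$-tuples $(A,B)$, $A=(a_1,\dots,a_k)$, $B=(b_1,\dots,b_k)$. Let $S=\langle G\rangle$. For any $j$ with $0\le j\le k$ and any $n\in\mathbb{Z}$, there is a unique representation $n=\sum_{i=0}^k n_ig_i$ where $n_0,\dots,n_k\in\mathbb{Z}$ with $0\le n_i<b_{i+1}$ if $0\le i<j$ and $0\le n_i<a_i$ if $j<i\le k$. Given such a representation, $n\in S$ if and only if $n_j\ge0$. Furthermore, $n\in \operatorname{Ap}(S;g_j)$ if and only if $n_j=0$.
   Context: For $k\in\mathbb{N}_0$ and $A=(a_1,\dots,a_k),B=(b_1,\dots,b_k)\in\mathbb{N}^k$, $(A,B)$ is a suitable pair if $\gcd(a_i,b_j)=1$ for all $i\ge j$. Then $g_i=b_1\cdots b_i a_{i+1}\cdots a_k$ for $0\le i\le k$, and $G(A,B)=(g_0,\dots,g_k)$ is a compound sequence; $\gcd(G(A,B))=1$, so $\langle G(A,B)\rangle$ (the set of non-negative integer combinations of the $g_i$) is a numerical semigroup. For nonzero $t\in S$, the Apéry set is $\operatorname{Ap}(S;t)=\{s\in S : s-t\notin S\}$. -}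

module Defs where

open import Data.Nat as ℕ using (ℕ; zero; suc; _∸_; _≤_; _<_)
open import Data.Nat.Coprimality using (Coprime)
open import Data.Integer as ℤ using (ℤ; +_; _-_)
open import Data.Product using (Σ; ∃; _×_)
open import Relation.Binary.PropositionalEquality using (_≡_)
open import Relation.Nullary using (¬_)

-- A k-tuple (x_1,…,x_k) is encoded as a function x : ℕ → ℕ; only the
-- values x 1, …, x k are relevant (all statements only look at them).

prodFrom : (ℕ → ℕ) → ℕ → ℕ → ℕ
prodFrom f lo zero    = 1
prodFrom f lo (suc n) = f lo ℕ.* prodFrom f (suc lo) n

sumTo : (ℕ → ℤ) → ℕ → ℤ
sumTo f zero    = f 0
sumTo f (suc k) = sumTo f k ℤ.+ f (suc k)

record Suitable (k : ℕ) (A B : ℕ → ℕ) : Set where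
  field
    A-pos    : ∀ i → 1 ≤ i → i ≤ k → 1 ≤ A i
    B-pos    : ∀ i → 1 ≤ i → i ≤ k → 1 ≤ B i
    coprime  : ∀ i j → 1 ≤ j → j ≤ i → i ≤ k → Coprime (A i) (B j)

g : ℕ → (A B : ℕ → ℕ) → ℕ → ℕ
g k A B i = prodFrom B 1 i ℕ.* prodFrom A (suc i) (k ∸ i)

InS : ℕ → (A B : ℕ → ℕ) → ℤ → Set
InS k A B n = Σ (ℕ → ℕ) λ c → n ≡ sumTo (λ i → + (c i ℕ.* g k A B i)) k

InAp : ℕ → (A B : ℕ → ℕ) → ℕ → ℤ → Set
InAp k A B j n = InS k A B n × ¬ InS k A B (n - + g k A B j)

Rep : ℕ → (A B : ℕ → ℕ) → ℕ → ℤ → (ℕ → ℤ) → Set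
Rep k A B j n c =
  (n ≡ sumTo (λ i → c i ℤ.* + g k A B i) k)
  × (∀ i → i < j → (+ 0 ℤ.≤ c i) × (c i ℤ.< + B (suc i)))
  × (∀ i → j < i → i ≤ k → (+ 0 ℤ.≤ c i) × (c i ℤ.< + A i))

-- The argument rests on three arithmetic facts about the gᵢ, established first:
--  • the exchange relation b_{i+1} gᵢ = a_{i+1} g_{i+1}, which lets units be carried between
--    neighbouring positions without changing the represented integer;
--  • for m < j, b₁⋯b_{m+1} divides every gᵢ with i > m while b_{m+1} is coprime to
--    gₘ / (b₁⋯bₘ) = a_{m+1}⋯a_k; symmetrically for m > j with aₘ⋯a_k;
--  • gcd(g₀, …, g_k) = 1, by induction on k using Bézout's identity.
-- Existence: write n as an integer combination of the gᵢ and normalise it by carries,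
-- chosen by Euclidean division from position 0 up to j - 1 and from position k down to j + 1.
-- Uniqueness: the difference of two representations is a combination of 0 with small
-- coefficients; the divisibility facts kill them from the outside in, and gⱼ ≠ 0 the last.
-- Membership: normalising a natural-number combination keeps the j-th coefficient nonnegative,
-- while nonnegative digits exhibit n ∈ S; the Apéry statement follows by comparing the
-- representations of n and n - gⱼ, which differ only by 1 at position j.
module Submission where

open import Defs
open import Data.Nat as ℕ using (ℕ; zero; suc; _∸_; _≤_; _<_; z≤n; s≤s)
import Data.Nat.Properties as ℕP
open import Data.Nat.Divisibility as ℕD using (_∣_; divides)
open import Data.Nat.Coprimality as Coprimality using (Coprime)
open import Data.Nat.GCD using (module Bézout)
import Data.Nat.Tactic.RingSolver as ℕSolver
open import Data.Integer as ℤ using (ℤ; +_; _+_; _*_; _-_; -_; 0ℤ; 1ℤ; +≤+; +<+; ∣_∣)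
  renaming (_≤_ to _≤ℤ_; _<_ to _<ℤ_)
import Data.Integer.Properties as ℤP
import Data.Integer.DivMod as ℤDivMod
open import Data.Integer.Divisibility.Signed as ℤD using () renaming (_∣_ to _∣ℤ_)
import Data.Integer.Tactic.RingSolver as ℤSolver
open import Data.Product using (Σ; ∃; _×_; _,_; proj₁)
open import Data.Sum using (inj₁; inj₂)
open import Function using (_∘_; case_of_)
open import Function.Bundles using (_⇔_; mk⇔; Equivalence)
open import Relation.Binary.Definitions using (tri<; tri≈; tri>)
open import Relation.Binary.PropositionalEquality
open import Relation.Nullary using (¬_; yes; no; contradiction)

prod-preserves : (P : ℕ → Set) → P 1 → (∀ {x y} → P x → P y → P (x ℕ.* y)) →
  ∀ f lo n → (∀ i → lo ≤ i → i < lo ℕ.+ n → P (f i)) → P (prodFrom f lo n)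
prod-preserves P P1 P* f lo zero    _  = P1
prod-preserves P P1 P* f lo (suc n) Pf =
  P* (Pf lo ℕP.≤-refl (ℕP.m<m+n lo (s≤s z≤n)))
     (prod-preserves P P1 P* f (suc lo) n λ i lo<i i<lo+n →
       Pf i (ℕP.<⇒≤ lo<i) (subst (i <_) (sym (ℕP.+-suc lo n)) i<lo+n))

prod-snoc : ∀ f lo n → prodFrom f lo (suc n) ≡ prodFrom f lo n ℕ.* f (lo ℕ.+ n)
prod-snoc f lo zero    rewrite ℕP.+-identityʳ lo = ℕP.*-comm (f lo) 1
prod-snoc f lo (suc n) = begin
  f lo ℕ.* prodFrom f (suc lo) (suc n)                 ≡⟨ cong (f lo ℕ.*_) (prod-snoc f (suc lo) n) ⟩
  f lo ℕ.* (prodFrom f (suc lo) n ℕ.* f (suc lo ℕ.+ n)) ≡⟨ sym (ℕP.*-assoc (f lo) _ _) ⟩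
  prodFrom f lo (suc n) ℕ.* f (suc lo ℕ.+ n)           ≡⟨ cong (λ i → prodFrom f lo (suc n) ℕ.* f i) (sym (ℕP.+-suc lo n)) ⟩
  prodFrom f lo (suc n) ℕ.* f (lo ℕ.+ suc n)           ∎
  where open ≡-Reasoning

coprime-* : ∀ {a m n} → Coprime a m → Coprime a n → Coprime a (m ℕ.* n)
coprime-* {a} {m} cm cn (d∣a , d∣mn) = cn (d∣a , Coprimality.coprime-divisor d-coprime-m d∣mn)
  where
  d-coprime-m : Coprime _ m
  d-coprime-m (e∣d , e∣m) = cm (ℕD.∣-trans e∣d d∣a , e∣m)

coprime-1 : ∀ a → Coprime a 1
coprime-1 a (_ , d∣1) = ℕD.∣1⇒≡1 d∣1

bPrefix : (B : ℕ → ℕ) → ℕ → ℕ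
bPrefix B i = prodFrom B 1 i

aSuffix : ℕ → (A : ℕ → ℕ) → ℕ → ℕ
aSuffix k A i = prodFrom A (suc i) (k ∸ i)

∸-suc : ∀ {i k} → i < k → k ∸ i ≡ suc (k ∸ suc i)
∸-suc i<k = ℕP.+-∸-assoc 1 i<k

bPrefix-suc : ∀ B i → bPrefix B (suc i) ≡ bPrefix B i ℕ.* B (suc i)
bPrefix-suc B i = prod-snoc B 1 i

aSuffix-pred : ∀ k A i → i < k → aSuffix k A i ≡ A (suc i) ℕ.* aSuffix k A (suc i)
aSuffix-pred k A i i<k rewrite ∸-suc i<k = refl

-- The exchange relation b_{i+1} gᵢ = a_{i+1} g_{i+1}: it lets carries move between positions.
g-exchange : ∀ k A B i → i < k → B (suc i) ℕ.* g k A B i ≡ A (suc i) ℕ.* g k A B (suc i)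
g-exchange k A B i i<k rewrite bPrefix-suc B i | aSuffix-pred k A i i<k =
  reorder (B (suc i)) (A (suc i)) (bPrefix B i) (aSuffix k A (suc i))
  where
  reorder : ∀ b a P Q → b ℕ.* (P ℕ.* (a ℕ.* Q)) ≡ a ℕ.* ((P ℕ.* b) ℕ.* Q)
  reorder = ℕSolver.solve-∀

bPrefix-∣ : ∀ B {m i} → m ≤ i → bPrefix B m ∣ bPrefix B i
bPrefix-∣ B {i = zero}  z≤n  = ℕD.∣-refl
bPrefix-∣ B {i = suc i} m≤1+i with ℕP.m≤n⇒m<n∨m≡n m≤1+i
... | inj₂ refl      = ℕD.∣-refl
... | inj₁ (s≤s m≤i) = ℕD.∣-trans (bPrefix-∣ B m≤i)
                         (subst (bPrefix B i ∣_) (sym (bPrefix-suc B i)) (ℕD.m∣m*n (B (suc i))))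

aSuffix-∣ : ∀ k A {i m} → i ≤ m → m ≤ k → aSuffix k A m ∣ aSuffix k A i
aSuffix-∣ k A {m = zero}  z≤n    _     = ℕD.∣-refl
aSuffix-∣ k A {m = suc m} i≤1+m 1+m≤k with ℕP.m≤n⇒m<n∨m≡n i≤1+m
... | inj₂ refl      = ℕD.∣-refl
... | inj₁ (s≤s i≤m) = ℕD.∣-trans (divides (A (suc m)) (aSuffix-pred k A m 1+m≤k))
                         (aSuffix-∣ k A i≤m (ℕP.<⇒≤ 1+m≤k))

g-extend : ∀ k A B i → i ≤ k → g (suc k) A B i ≡ g k A B i ℕ.* A (suc k)
g-extend k A B i i≤k = begin
  bPrefix B i ℕ.* prodFrom A (suc i) (suc k ∸ i)
    ≡⟨ cong (λ n → bPrefix B i ℕ.* prodFrom A (suc i) n) (ℕP.+-∸-assoc 1 i≤k) ⟩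
  bPrefix B i ℕ.* prodFrom A (suc i) (suc (k ∸ i))
    ≡⟨ cong (bPrefix B i ℕ.*_) (prod-snoc A (suc i) (k ∸ i)) ⟩
  bPrefix B i ℕ.* (aSuffix k A i ℕ.* A (suc (i ℕ.+ (k ∸ i))))
    ≡⟨ cong (λ l → bPrefix B i ℕ.* (aSuffix k A i ℕ.* A (suc l))) (ℕP.m+[n∸m]≡n i≤k) ⟩
  bPrefix B i ℕ.* (aSuffix k A i ℕ.* A (suc k))
    ≡⟨ sym (ℕP.*-assoc (bPrefix B i) (aSuffix k A i) (A (suc k))) ⟩
  g k A B i ℕ.* A (suc k) ∎
  where open ≡-Reasoning

g-last : ∀ k A B → g k A B k ≡ bPrefix B k
g-last k A B rewrite ℕP.n∸n≡0 k = ℕP.*-identityʳ (bPrefix B k)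

suitable-init : ∀ {k A B} → Suitable (suc k) A B → Suitable k A B
suitable-init s = record
  { A-pos   = λ i 1≤i i≤k → A-pos i 1≤i (ℕP.m≤n⇒m≤1+n i≤k)
  ; B-pos   = λ i 1≤i i≤k → B-pos i 1≤i (ℕP.m≤n⇒m≤1+n i≤k)
  ; coprime = λ i j 1≤j j≤i i≤k → coprime i j 1≤j j≤i (ℕP.m≤n⇒m≤1+n i≤k) }
  where open Suitable s

module _ {k : ℕ} {A B : ℕ → ℕ} (suitable : Suitable k A B) where
  open Suitable suitable

  private
    suffix-bound : ∀ {i l} → i ≤ k → l < suc i ℕ.+ (k ∸ i) → l ≤ k
    suffix-bound {i} {l} i≤k l<end = ℕP.≤-pred (subst (l <_) (cong suc (ℕP.m+[n∸m]≡n i≤k)) l<end)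

  bPrefix-pos : ∀ {i} → i ≤ k → 1 ≤ bPrefix B i
  bPrefix-pos {i} i≤k = prod-preserves (1 ≤_) ℕP.≤-refl ℕP.*-mono-≤ B 1 i
    λ l 1≤l l<1+i → B-pos l 1≤l (ℕP.≤-trans (ℕP.≤-pred l<1+i) i≤k)

  aSuffix-pos : ∀ {i} → i ≤ k → 1 ≤ aSuffix k A i
  aSuffix-pos {i} i≤k = prod-preserves (1 ≤_) ℕP.≤-refl ℕP.*-mono-≤ A (suc i) (k ∸ i)
    λ l 1+i≤l l<end → A-pos l (ℕP.≤-trans (s≤s z≤n) 1+i≤l) (suffix-bound i≤k l<end)

  g-pos : ∀ {i} → i ≤ k → 1 ≤ g k A B i
  g-pos i≤k = ℕP.*-mono-≤ (bPrefix-pos i≤k) (aSuffix-pos i≤k)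

  B-coprime-aSuffix : ∀ {m} → m < k → Coprime (B (suc m)) (aSuffix k A m)
  B-coprime-aSuffix {m} m<k = prod-preserves (Coprime (B (suc m))) (coprime-1 _) coprime-* A (suc m) (k ∸ m)
    λ l 1+m≤l l<end → Coprimality.sym (coprime l (suc m) (s≤s z≤n) 1+m≤l (suffix-bound (ℕP.<⇒≤ m<k) l<end))

  A-coprime-bPrefix : ∀ {m} → m ≤ k → Coprime (A m) (bPrefix B m)
  A-coprime-bPrefix {m} m≤k = prod-preserves (Coprime (A m)) (coprime-1 _) coprime-* B 1 m
    λ l 1≤l l<1+m → coprime m l 1≤l (ℕP.≤-pred l<1+m) m≤k

sum-cong : ∀ {f h} k → (∀ i → i ≤ k → f i ≡ h i) → sumTo f k ≡ sumTo h k
sum-cong zero    f≗h = f≗h 0 z≤n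
sum-cong (suc k) f≗h = cong₂ _+_ (sum-cong k λ i i≤k → f≗h i (ℕP.m≤n⇒m≤1+n i≤k)) (f≗h (suc k) ℕP.≤-refl)

sum-scale : ∀ x f k → sumTo (λ i → x * f i) k ≡ x * sumTo f k
sum-scale x f zero    = refl
sum-scale x f (suc k) = trans (cong (_+ x * f (suc k)) (sum-scale x f k))
                              (sym (ℤP.*-distribˡ-+ x (sumTo f k) (f (suc k))))

sum-sub : ∀ f h k → sumTo (λ i → f i - h i) k ≡ sumTo f k - sumTo h k
sum-sub f h zero    = refl
sum-sub f h (suc k) = trans (cong (_+ (f (suc k) - h (suc k))) (sum-sub f h k))
                            (interchange (sumTo f k) (sumTo h k) (f (suc k)) (h (suc k)))
  where
  interchange : ∀ a b c d → (a - b) + (c - d) ≡ (a + c) - (b + d)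
  interchange = ℤSolver.solve-∀

sum-zero : ∀ f k → (∀ i → i ≤ k → f i ≡ 0ℤ) → sumTo f k ≡ 0ℤ
sum-zero f zero    f≡0 = f≡0 0 z≤n
sum-zero f (suc k) f≡0 = cong₂ _+_ (sum-zero f k λ i i≤k → f≡0 i (ℕP.m≤n⇒m≤1+n i≤k)) (f≡0 (suc k) ℕP.≤-refl)

combination-sub : ∀ (G c c′ : ℕ → ℤ) k →
  sumTo (λ i → (c i - c′ i) * G i) k ≡ sumTo (λ i → c i * G i) k - sumTo (λ i → c′ i * G i) k
combination-sub G c c′ k = trans (sum-cong k λ i _ → distrib (c i) (c′ i) (G i)) (sum-sub _ _ k)
  where
  distrib : ∀ x y z → (x - y) * z ≡ x * z - y * z
  distrib = ℤSolver.solve-∀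

sum-single : ∀ f {m} k → m ≤ k → (∀ i → i ≤ k → i ≢ m → f i ≡ 0ℤ) → sumTo f k ≡ f m
sum-single f zero z≤n _ = refl
sum-single f {m} (suc k) m≤1+k others with m ℕ.≟ suc k
... | yes refl = trans (cong (_+ f m) (sum-zero f k λ i i≤k → others i (ℕP.m≤n⇒m≤1+n i≤k) (ℕP.<⇒≢ (s≤s i≤k))))
                       (ℤP.+-identityˡ (f m))
... | no m≢1+k = trans (cong₂ _+_ (sum-single f k (ℕP.≤-pred (ℕP.≤∧≢⇒< m≤1+k m≢1+k))
                                     λ i i≤k → others i (ℕP.m≤n⇒m≤1+n i≤k))
                                  (others (suc k) ℕP.≤-refl (m≢1+k ∘ sym)))
                       (ℤP.+-identityʳ (f m))

∣-sum : ∀ {d} f k → (∀ i → i ≤ k → d ∣ℤ f i) → d ∣ℤ sumTo f k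
∣-sum f zero    d∣f = d∣f 0 z≤n
∣-sum f (suc k) d∣f = ℤD.∣m∣n⇒∣m+n (∣-sum f k λ i i≤k → d∣f i (ℕP.m≤n⇒m≤1+n i≤k)) (d∣f (suc k) ℕP.≤-refl)

∣-sum-except : ∀ {d} f {m} k → m ≤ k → d ∣ℤ sumTo f k →
  (∀ i → i ≤ k → i ≢ m → d ∣ℤ f i) → d ∣ℤ f m
∣-sum-except f zero z≤n d∣sum _ = d∣sum
∣-sum-except f {m} (suc k) m≤1+k d∣sum others with m ℕ.≟ suc k
... | yes refl = ℤD.∣m+n∣m⇒∣n d∣sum (∣-sum f k λ i i≤k → others i (ℕP.m≤n⇒m≤1+n i≤k) (ℕP.<⇒≢ (s≤s i≤k)))
... | no m≢1+k = ∣-sum-except f k (ℕP.≤-pred (ℕP.≤∧≢⇒< m≤1+k m≢1+k))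
                   (ℤD.∣m+n∣n⇒∣m d∣sum (others (suc k) ℕP.≤-refl (m≢1+k ∘ sym)))
                   λ i i≤k → others i (ℕP.m≤n⇒m≤1+n i≤k)

Combination : ℕ → (A B : ℕ → ℕ) → ℤ → Set
Combination k A B n = Σ (ℕ → ℤ) λ d → n ≡ sumTo (λ i → d i * + g k A B i) k

liftℤ : ∀ r p s q → 1 ℕ.+ s ℕ.* q ≡ r ℕ.* p → 1ℤ + + s * + q ≡ + r * + p
liftℤ r p s q eq = begin
  1ℤ + + s * + q    ≡⟨ cong (λ t → 1ℤ + t) (sym (ℤP.pos-* s q)) ⟩
  + (1 ℕ.+ s ℕ.* q) ≡⟨ cong +_ eq ⟩
  + (r ℕ.* p)       ≡⟨ ℤP.pos-* r p ⟩
  + r * + p         ∎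
  where open ≡-Reasoning

bézout : ∀ {a p} → Coprime a p → Σ ℤ λ u → Σ ℤ λ v → 1ℤ ≡ u * + a + v * + p
bézout {a} {p} a⊥p with Coprimality.coprime-Bézout a⊥p
... | Bézout.+- x y 1+yp≡xa = + x , - + y , (begin
  1ℤ                             ≡⟨ add-sub (+ y) (+ p) ⟩
  (1ℤ + + y * + p) + - + y * + p ≡⟨ cong (_+ - + y * + p) (liftℤ x a y p 1+yp≡xa) ⟩
  + x * + a + - + y * + p        ∎)
  where
  open ≡-Reasoning
  add-sub : ∀ y p → 1ℤ ≡ (1ℤ + y * p) + - y * p
  add-sub = ℤSolver.solve-∀
... | Bézout.-+ x y 1+xa≡yp = - + x , + y , (begin
  1ℤ                             ≡⟨ sub-add (+ x) (+ a) ⟩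
  - + x * + a + (1ℤ + + x * + a) ≡⟨ cong (λ t → - + x * + a + t) (liftℤ y p x a 1+xa≡yp) ⟩
  - + x * + a + + y * + p        ∎)
  where
  open ≡-Reasoning
  sub-add : ∀ x a → 1ℤ ≡ - x * a + (1ℤ + x * a)
  sub-add = ℤSolver.solve-∀

extend : ℕ → (ℕ → ℤ) → ℤ → ℕ → ℤ
extend k d v i with i ℕ.≤? k
... | yes _ = d i
... | no  _ = v

extend-≤ : ∀ {k d v i} → i ≤ k → extend k d v i ≡ d i
extend-≤ {k} {i = i} i≤k with i ℕ.≤? k
... | yes _   = refl
... | no  i≰k = contradiction i≤k i≰k

extend-last : ∀ {k d v} → extend k d v (suc k) ≡ v
extend-last {k} with suc k ℕ.≤? k
... | yes 1+k≤k = contradiction 1+k≤k (ℕP.n≮n k)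
... | no  _     = refl

-- By induction on k: if 1 = Σ_{i≤k} dᵢ gᵢ and 1 = u a_{k+1} + v b₁⋯b_{k+1}, then
-- 1 = Σ_{i≤k} (u dᵢ) (gᵢ a_{k+1}) + v g_{k+1}.
one-combination : ∀ k A B → Suitable k A B → Combination k A B 1ℤ
one-combination zero    A B _ = (λ _ → 1ℤ) , refl
one-combination (suc k) A B suitable
  with one-combination k A B (suitable-init suitable)
     | bézout (A-coprime-bPrefix suitable (ℕP.≤-refl {suc k}))
... | d , 1≡Σdg | u , v , 1≡ua+vb = d′ , trans 1≡ua+vb (sym (cong₂ _+_ lower-terms last-term))
  where
  d′ : ℕ → ℤ
  d′ = extend k (λ i → u * d i) v

  reassociate : ∀ u d g a → u * d * (g * a) ≡ (u * a) * (d * g)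
  reassociate = ℤSolver.solve-∀

  lower-terms : sumTo (λ i → d′ i * + g (suc k) A B i) k ≡ u * + A (suc k)
  lower-terms = begin
    sumTo (λ i → d′ i * + g (suc k) A B i) k
      ≡⟨ sum-cong k (λ i i≤k → begin
           d′ i * + g (suc k) A B i ≡⟨ cong₂ (λ c n → c * + n) (extend-≤ {v = v} i≤k) (g-extend k A B i i≤k) ⟩
           u * d i * + (g k A B i ℕ.* A (suc k)) ≡⟨ cong (u * d i *_) (ℤP.pos-* (g k A B i) (A (suc k))) ⟩
           u * d i * (+ g k A B i * + A (suc k)) ≡⟨ reassociate u (d i) _ _ ⟩
           (u * + A (suc k)) * (d i * + g k A B i) ∎) ⟩
    sumTo (λ i → (u * + A (suc k)) * (d i * + g k A B i)) k
      ≡⟨ sum-scale (u * + A (suc k)) (λ i → d i * + g k A B i) k ⟩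
    (u * + A (suc k)) * sumTo (λ i → d i * + g k A B i) k
      ≡⟨ cong ((u * + A (suc k)) *_) (sym 1≡Σdg) ⟩
    (u * + A (suc k)) * 1ℤ
      ≡⟨ ℤP.*-identityʳ (u * + A (suc k)) ⟩
    u * + A (suc k) ∎
    where open ≡-Reasoning

  last-term : d′ (suc k) * + g (suc k) A B (suc k) ≡ v * + bPrefix B (suc k)
  last-term = cong₂ (λ c n → c * + n) (extend-last {k} {λ i → u * d i}) (g-last (suc k) A B)

-- Every integer is an integer combination of the gᵢ: scale a combination of 1.
combination : ∀ k A B → Suitable k A B → (n : ℤ) → Combination k A B n
combination k A B suitable n with one-combination k A B suitable
... | d , 1≡Σdg = (λ i → n * d i) , (begin
  n                                                 ≡⟨ sym (ℤP.*-identityʳ n) ⟩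
  n * 1ℤ                                            ≡⟨ cong (n *_) 1≡Σdg ⟩
  n * sumTo (λ i → d i * + g k A B i) k             ≡⟨ sym (sum-scale n _ k) ⟩
  sumTo (λ i → n * (d i * + g k A B i)) k           ≡⟨ sum-cong k (λ i _ → sym (ℤP.*-assoc n (d i) _)) ⟩
  sumTo (λ i → n * d i * + g k A B i) k             ∎)
  where open ≡-Reasoning

InRange : ℕ → ℤ → Set
InRange n x = (0ℤ ≤ℤ x) × (x <ℤ + n)

digit-difference : ∀ {n x y} → InRange n x → InRange n y → ∣ x - y ∣ < n
digit-difference {x = + a} {+ b} (_ , +<+ a<n) (_ , +<+ b<n) rewrite ℤP.[+m]-[+n]≡m⊖n a b =
  ℕP.≤-<-trans (ℤP.∣m⊝n∣≤m⊔n a b) (ℕP.⊔-pres-<m a<n b<n)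

-- Integer division by a natural number, with the convention x / 0 = 0.
quot : ℤ → ℕ → ℤ
quot x zero    = 0ℤ
quot x (suc n) = x ℤDivMod./ℕ suc n

quot-remainder : ∀ x {n} → 1 ≤ n → InRange n (x - + n * quot x n)
quot-remainder x {suc n} _ = subst (InRange (suc n)) (sym remainder≡) (+≤+ z≤n , +<+ (ℤDivMod.n%ℕd<d x (suc n)))
  where
  cancel : ∀ r q n → r + q * n - n * q ≡ r
  cancel = ℤSolver.solve-∀
  remainder≡ : x - + suc n * quot x (suc n) ≡ + (x ℤDivMod.%ℕ suc n)
  remainder≡ = trans (cong (λ t → t - + suc n * quot x (suc n)) (ℤDivMod.a≡a%ℕn+[a/ℕn]*n x (suc n)))
                     (cancel _ (quot x (suc n)) (+ suc n))

quot-nonneg : ∀ {x} n → 0ℤ ≤ℤ x → 0ℤ ≤ℤ quot x n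
quot-nonneg         zero    _ = +≤+ z≤n
quot-nonneg {+ _}   (suc n) _ = +≤+ z≤n

nonneg-* : ∀ a {x} → 0ℤ ≤ℤ x → 0ℤ ≤ℤ + a * x
nonneg-* a {+ m} _ = subst (0ℤ ≤ℤ_) (ℤP.pos-* a m) (+≤+ z≤n)

-- Carrying: fᵢ units are moved out of position i (costing b_{i+1} gᵢ each) into position i+1
-- (worth a_{i+1} g_{i+1} each); by the exchange relation the represented integer is unchanged.
incoming : (A : ℕ → ℕ) (d f : ℕ → ℤ) → ℕ → ℤ
incoming A d f zero    = d 0
incoming A d f (suc i) = d (suc i) + + A (suc i) * f i

carry : (A B : ℕ → ℕ) (d f : ℕ → ℤ) → ℕ → ℤ
carry A B d f i = incoming A d f i - + B (suc i) * f i

module _ (k : ℕ) (A B : ℕ → ℕ) (d f : ℕ → ℤ) where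
  private
    G : ℕ → ℤ
    G i = + g k A B i

  -- Up to position m, carrying changes the sum only by the units f_m still in transit.
  carry-partial : ∀ m → m ≤ k →
    sumTo (λ i → carry A B d f i * G i) m ≡ sumTo (λ i → d i * G i) m - f m * (+ B (suc m) * G m)
  carry-partial zero _ = first (d 0) (+ B 1) (f 0) (G 0)
    where
    first : ∀ d b f g → (d - b * f) * g ≡ d * g - f * (b * g)
    first = ℤSolver.solve-∀
  carry-partial (suc m) m<k = begin
    sumTo (λ i → carry A B d f i * G i) m + carry A B d f (suc m) * G (suc m)
      ≡⟨ cong (_+ carry A B d f (suc m) * G (suc m)) (carry-partial m (ℕP.<⇒≤ m<k)) ⟩
    sumTo (λ i → d i * G i) m - f m * (+ B (suc m) * G m) + carry A B d f (suc m) * G (suc m)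
      ≡⟨ cong (λ t → sumTo (λ i → d i * G i) m - f m * t + carry A B d f (suc m) * G (suc m)) exchange ⟩
    sumTo (λ i → d i * G i) m - f m * (+ A (suc m) * G (suc m)) + carry A B d f (suc m) * G (suc m)
      ≡⟨ step (sumTo (λ i → d i * G i) m) (f m) (+ A (suc m)) (G (suc m)) (d (suc m)) (+ B (suc (suc m))) (f (suc m)) ⟩
    sumTo (λ i → d i * G i) (suc m) - f (suc m) * (+ B (suc (suc m)) * G (suc m)) ∎
    where
    open ≡-Reasoning
    exchange : + B (suc m) * G m ≡ + A (suc m) * G (suc m)
    exchange = begin
      + B (suc m) * G m               ≡⟨ sym (ℤP.pos-* (B (suc m)) _) ⟩
      + (B (suc m) ℕ.* g k A B m)     ≡⟨ cong +_ (g-exchange k A B m m<k) ⟩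
      + (A (suc m) ℕ.* g k A B (suc m)) ≡⟨ ℤP.pos-* (A (suc m)) _ ⟩
      + A (suc m) * G (suc m)         ∎
    step : ∀ X u a G′ d′ b′ v → X - u * (a * G′) + (d′ + a * u - b′ * v) * G′ ≡ (X + d′ * G′) - v * (b′ * G′)
    step = ℤSolver.solve-∀

  carry-sum : f k ≡ 0ℤ → sumTo (λ i → carry A B d f i * G i) k ≡ sumTo (λ i → d i * G i) k
  carry-sum fk≡0 = begin
    sumTo (λ i → carry A B d f i * G i) k         ≡⟨ carry-partial k ℕP.≤-refl ⟩
    sumTo (λ i → d i * G i) k - f k * (+ B (suc k) * G k) ≡⟨ cong (λ t → sumTo (λ i → d i * G i) k - t * (+ B (suc k) * G k)) fk≡0 ⟩
    sumTo (λ i → d i * G i) k - 0ℤ * (+ B (suc k) * G k) ≡⟨ ℤP.+-identityʳ _ ⟩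
    sumTo (λ i → d i * G i) k                   ∎
    where open ≡-Reasoning

module Normalise {k : ℕ} {A B : ℕ → ℕ} (suitable : Suitable k A B) {j : ℕ} (j≤k : j ≤ k) (d : ℕ → ℤ) where
  open Suitable suitable

  -- Left of j, carries go rightwards, chosen greedily from position 0 on.
  leftCarry : ℕ → ℤ
  leftCarry zero    = quot (d 0) (B 1)
  leftCarry (suc i) = quot (d (suc i) + + A (suc i) * leftCarry i) (B (suc (suc i)))

  leftCarry-eq : ∀ i → leftCarry i ≡ quot (incoming A d leftCarry i) (B (suc i))
  leftCarry-eq zero    = refl
  leftCarry-eq (suc i) = refl

  -- From j on, carries go leftwards, chosen greedily from position k down: borrow m units leave
  -- position k - m + 1 for position k - m, so the carry out of position i is -(borrow (k - i)).
  borrow : ℕ → ℤ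
  borrow zero    = 0ℤ
  borrow (suc m) = quot (d (k ∸ m) + + B (suc (k ∸ m)) * borrow m) (A (k ∸ m))

  carries : ℕ → ℤ
  carries i with i ℕ.<? j
  ... | yes _ = leftCarry i
  ... | no  _ = - borrow (k ∸ i)

  carries-left : ∀ {i} → i < j → carries i ≡ leftCarry i
  carries-left {i} i<j with i ℕ.<? j
  ... | yes _   = refl
  ... | no  i≮j = contradiction i<j i≮j

  carries-right : ∀ {i} → j ≤ i → carries i ≡ - borrow (k ∸ i)
  carries-right {i} j≤i with i ℕ.<? j
  ... | yes i<j = contradiction j≤i (ℕP.<⇒≱ i<j)
  ... | no  _   = refl

  -- The normalised coefficients; nothing is carried out of position k, so the sum is unchanged.
  normal : ℕ → ℤ
  normal = carry A B d carries

  normal-sum : sumTo (λ i → normal i * + g k A B i) k ≡ sumTo (λ i → d i * + g k A B i) k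
  normal-sum = carry-sum k A B d carries (trans (carries-right j≤k) (cong (λ m → - borrow m) (ℕP.n∸n≡0 k)))

  incoming-left : ∀ {i} → i < j → incoming A d carries i ≡ incoming A d leftCarry i
  incoming-left {zero}  _   = refl
  incoming-left {suc i} i<j = cong (λ t → d (suc i) + + A (suc i) * t) (carries-left (ℕP.<-trans (ℕP.n<1+n i) i<j))

  normal-left : ∀ i → i < j → InRange (B (suc i)) (normal i)
  normal-left i i<j = subst (InRange (B (suc i))) (sym normal≡)
    (quot-remainder t (B-pos (suc i) (s≤s z≤n) (ℕP.≤-trans i<j j≤k)))
    where
    t = incoming A d leftCarry i
    normal≡ : normal i ≡ t - + B (suc i) * quot t (B (suc i))
    normal≡ rewrite incoming-left i<j | carries-left i<j | leftCarry-eq i = refl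

  normal-right : ∀ i → j < i → i ≤ k → InRange (A i) (normal i)
  normal-right (suc i) j<1+i 1+i≤k = subst (InRange (A (suc i))) (sym normal≡)
    (quot-remainder t (A-pos (suc i) (s≤s z≤n) 1+i≤k))
    where
    t = d (suc i) + + B (suc (suc i)) * borrow (k ∸ suc i)
    borrow-eq : borrow (k ∸ i) ≡ quot t (A (suc i))
    borrow-eq rewrite ∸-suc 1+i≤k | ℕP.m∸[m∸n]≡n 1+i≤k = refl
    rearrange : ∀ d a b P Q → d + a * (- P) - b * (- Q) ≡ (d + b * Q) - a * P
    rearrange = ℤSolver.solve-∀
    normal≡ : normal (suc i) ≡ t - + A (suc i) * quot t (A (suc i))
    normal≡ rewrite carries-right (ℕP.≤-pred j<1+i) | carries-right (ℕP.<⇒≤ j<1+i) | sym borrow-eq =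
      rearrange (d (suc i)) (+ A (suc i)) (+ B (suc (suc i))) (borrow (k ∸ i)) (borrow (k ∸ suc i))

  module _ (d≥0 : ∀ i → 0ℤ ≤ℤ d i) where
    leftCarry-nonneg : ∀ i → 0ℤ ≤ℤ leftCarry i
    leftCarry-nonneg zero    = quot-nonneg (B 1) (d≥0 0)
    leftCarry-nonneg (suc i) = quot-nonneg (B (suc (suc i))) (ℤP.+-mono-≤ (d≥0 (suc i)) (nonneg-* (A (suc i)) (leftCarry-nonneg i)))

    borrow-nonneg : ∀ m → 0ℤ ≤ℤ borrow m
    borrow-nonneg zero    = +≤+ z≤n
    borrow-nonneg (suc m) = quot-nonneg (A (k ∸ m)) (ℤP.+-mono-≤ (d≥0 (k ∸ m)) (nonneg-* (B (suc (k ∸ m))) (borrow-nonneg m)))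

    incoming-nonneg : ∀ i → i ≤ j → 0ℤ ≤ℤ incoming A d carries i
    incoming-nonneg zero    _     = d≥0 0
    incoming-nonneg (suc i) 1+i≤j = ℤP.+-mono-≤ (d≥0 (suc i))
      (nonneg-* (A (suc i)) (subst (0ℤ ≤ℤ_) (sym (carries-left 1+i≤j)) (leftCarry-nonneg i)))

    normal-nonneg : 0ℤ ≤ℤ normal j
    normal-nonneg = subst (0ℤ ≤ℤ_) (sym normal≡)
      (ℤP.+-mono-≤ (incoming-nonneg j ℕP.≤-refl) (nonneg-* (B (suc j)) (borrow-nonneg (k ∸ j))))
      where
      minus-neg : ∀ X b P → X - b * (- P) ≡ X + b * P
      minus-neg = ℤSolver.solve-∀
      normal≡ : normal j ≡ incoming A d carries j + + B (suc j) * borrow (k ∸ j)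
      normal≡ = trans (cong (λ t → incoming A d carries j - + B (suc j) * t) (carries-right ℕP.≤-refl))
                      (minus-neg (incoming A d carries j) (+ B (suc j)) (borrow (k ∸ j)))

∣∧<⇒≡0 : ∀ {b n} → b ∣ n → n < b → n ≡ 0
∣∧<⇒≡0 {n = zero}  _   _   = refl
∣∧<⇒≡0 {n = suc n} b∣n n<b = contradiction b∣n (ℕD.>⇒∤ n<b)

cancel-digit : ∀ x {p b q} → 1 ≤ p → Coprime b q → ∣ x ∣ < b → + (p ℕ.* b) ∣ℤ x * + (p ℕ.* q) → x ≡ 0ℤ
cancel-digit x {suc p′} {b} {q} _ b⊥q |x|<b pb∣xpq = ℤP.∣i∣≡0⇒i≡0 (∣∧<⇒≡0 b∣|x| |x|<b)
  where
  p = suc p′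
  |xpq|≡ : ∣ x * + (p ℕ.* q) ∣ ≡ p ℕ.* (q ℕ.* ∣ x ∣)
  |xpq|≡ = trans (ℤP.abs-* x (+ (p ℕ.* q))) (reorder ∣ x ∣ p q)
    where
    reorder : ∀ x p q → x ℕ.* (p ℕ.* q) ≡ p ℕ.* (q ℕ.* x)
    reorder = ℕSolver.solve-∀
  b∣|x| : b ∣ ∣ x ∣
  b∣|x| = Coprimality.coprime-divisor b⊥q (ℕD.*-cancelˡ-∣ p (subst (p ℕ.* b ∣_) |xpq|≡ (ℤD.∣⇒∣ᵤ pb∣xpq)))

-- Coefficients are killed from the outside in: at
-- position m < j, b₁⋯b_{m+1} divides every other surviving term, and cancel-digit applies;
-- symmetrically at m > j with a_m⋯a_k; finally e_j g_j = 0 with g_j ≠ 0.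
module Vanishing {k : ℕ} {A B : ℕ → ℕ} (suitable : Suitable k A B) {j : ℕ} (j≤k : j ≤ k) (e : ℕ → ℤ)
  (e-sum   : sumTo (λ i → e i * + g k A B i) k ≡ 0ℤ)
  (e-left  : ∀ i → i < j → ∣ e i ∣ < B (suc i))
  (e-right : ∀ i → j < i → i ≤ k → ∣ e i ∣ < A i) where

  private
    G : ℕ → ℤ
    G i = + g k A B i

  isolate : ∀ {P} m → m ≤ k → (∀ i → i ≤ k → i ≢ m → P ∣ℤ e i * G i) → P ∣ℤ e m * G m
  isolate {P} m m≤k = ∣-sum-except (λ i → e i * G i) k m≤k
    (subst (P ∣ℤ_) (sym e-sum) (ℤD.divides 0ℤ (sym (ℤP.*-zeroˡ P))))

  vanished : ∀ {P} i → e i ≡ 0ℤ → P ∣ℤ e i * G i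
  vanished {P} i eᵢ≡0 = ℤD.divides 0ℤ (trans (cong (_* G i) eᵢ≡0) (sym (ℤP.*-zeroˡ P)))

  step-left : ∀ m → m < j → (∀ i → i < m → e i ≡ 0ℤ) → e m ≡ 0ℤ
  step-left m m<j below = cancel-digit (e m) (bPrefix-pos suitable m≤k) (B-coprime-aSuffix suitable m<k) (e-left m m<j)
    (subst (λ D → + D ∣ℤ e m * G m) (bPrefix-suc B m) (isolate m m≤k others))
    where
    m<k = ℕP.<-≤-trans m<j j≤k
    m≤k = ℕP.<⇒≤ m<k
    others : ∀ i → i ≤ k → i ≢ m → + bPrefix B (suc m) ∣ℤ e i * G i
    others i _ i≢m with ℕP.<-cmp i m
    ... | tri< i<m _ _ = vanished i (below i i<m)
    ... | tri≈ _ i≡m _ = contradiction i≡m i≢m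
    ... | tri> _ _ m<i = ℤD.∣n⇒∣m*n (e i) (ℤD.∣ᵤ⇒∣ (ℕD.∣-trans (bPrefix-∣ B m<i) (ℕD.m∣m*n (aSuffix k A i))))

  step-right : ∀ m → j < m → m ≤ k → (∀ i → m < i → i ≤ k → e i ≡ 0ℤ) → e m ≡ 0ℤ
  step-right (suc m) j<1+m 1+m≤k above = cancel-digit (e (suc m)) (aSuffix-pos suitable 1+m≤k)
    (A-coprime-bPrefix suitable 1+m≤k) (e-right (suc m) j<1+m 1+m≤k)
    (subst₂ (λ D E → + D ∣ℤ e (suc m) * + E)
      (trans (aSuffix-pred k A m 1+m≤k) (ℕP.*-comm (A (suc m)) _)) (ℕP.*-comm (bPrefix B (suc m)) _)
      (isolate (suc m) 1+m≤k others))
    where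
    others : ∀ i → i ≤ k → i ≢ suc m → + aSuffix k A m ∣ℤ e i * G i
    others i i≤k i≢1+m with ℕP.<-cmp i (suc m)
    ... | tri< i<1+m _ _ = ℤD.∣n⇒∣m*n (e i)
                             (ℤD.∣ᵤ⇒∣ (ℕD.∣-trans (aSuffix-∣ k A (ℕP.≤-pred i<1+m) (ℕP.<⇒≤ 1+m≤k)) (ℕD.n∣m*n (bPrefix B i))))
    ... | tri≈ _ i≡1+m _ = contradiction i≡1+m i≢1+m
    ... | tri> _ _ 1+m<i = vanished i (above i 1+m<i i≤k)

  -- Upward induction below j, and downward induction above j (on a bound t for k - i).
  vanish-left : ∀ m → m ≤ j → ∀ i → i < m → e i ≡ 0ℤ
  vanish-left (suc m) 1+m≤j i i<1+m with ℕP.m≤n⇒m<n∨m≡n (ℕP.≤-pred i<1+m)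
  ... | inj₁ i<m  = vanish-left m (ℕP.<⇒≤ 1+m≤j) i i<m
  ... | inj₂ refl = step-left i 1+m≤j (vanish-left i (ℕP.<⇒≤ 1+m≤j))

  vanish-right : ∀ t i → j < i → i ≤ k → k ≤ t ℕ.+ i → e i ≡ 0ℤ
  vanish-right zero i j<i i≤k k≤i = step-right i j<i i≤k
    λ i′ i<i′ i′≤k → contradiction (ℕP.<-≤-trans i<i′ (ℕP.≤-trans i′≤k k≤i)) (ℕP.n≮n i)
  vanish-right (suc t) i j<i i≤k k≤1+t+i = step-right i j<i i≤k
    λ i′ i<i′ i′≤k → vanish-right t i′ (ℕP.<-trans j<i i<i′) i′≤k
      (ℕP.≤-trans k≤1+t+i (subst (ℕ._≤ t ℕ.+ i′) (ℕP.+-suc t i) (ℕP.+-monoʳ-≤ t i<i′)))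

  middle-term : sumTo (λ i → e i * G i) k ≡ e j * G j
  middle-term = sum-single (λ i → e i * G i) k j≤k others
    where
    others : ∀ i → i ≤ k → i ≢ j → e i * G i ≡ 0ℤ
    others i i≤k i≢j with ℕP.<-cmp i j
    ... | tri< i<j _ _ = cong (_* G i) (vanish-left j ℕP.≤-refl i i<j)
    ... | tri≈ _ i≡j _ = contradiction i≡j i≢j
    ... | tri> _ _ j<i = cong (_* G i) (vanish-right k i j<i i≤k (ℕP.m≤m+n k i))

  vanish-middle : e j ≡ 0ℤ
  vanish-middle with ℤP.i*j≡0⇒i≡0∨j≡0 (e j) (trans (sym middle-term) e-sum)
  ... | inj₁ eⱼ≡0 = eⱼ≡0
  ... | inj₂ Gⱼ≡0 = contradiction (cong ∣_∣ Gⱼ≡0) (ℕP.m<n⇒n≢0 (g-pos suitable j≤k))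

  vanish : ∀ i → i ≤ k → e i ≡ 0ℤ
  vanish i i≤k with ℕP.<-cmp i j
  ... | tri< i<j _ _  = vanish-left j ℕP.≤-refl i i<j
  ... | tri≈ _ refl _ = vanish-middle
  ... | tri> _ _ j<i  = vanish-right k i j<i i≤k (ℕP.m≤m+n k i)

unit : ℕ → ℕ → ℤ
unit j i with i ℕ.≟ j
... | yes _ = 1ℤ
... | no  _ = 0ℤ

unit-off : ∀ {j i} → i ≢ j → unit j i ≡ 0ℤ
unit-off {j} {i} i≢j with i ℕ.≟ j
... | yes i≡j = contradiction i≡j i≢j
... | no  _   = refl

unit-on : ∀ j → unit j j ≡ 1ℤ
unit-on j with j ℕ.≟ j
... | yes _   = refl
... | no  j≢j = contradiction refl j≢j

module Representation {k : ℕ} {A B : ℕ → ℕ} (suitable : Suitable k A B) {j : ℕ} (j≤k : j ≤ k) where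
  private
    G : ℕ → ℤ
    G i = + g k A B i

  normal-rep : ∀ {n} d → n ≡ sumTo (λ i → d i * G i) k → Rep k A B j n (Normalise.normal suitable j≤k d)
  normal-rep d n≡Σ = trans n≡Σ (sym (normal-sum d)) , normal-left d , normal-right d
    where open Normalise suitable j≤k

  rep-exists : ∀ n → ∃ λ c → Rep k A B j n c
  rep-exists n with combination k A B suitable n
  ... | d , n≡Σ = _ , normal-rep d n≡Σ

  rep-unique : ∀ {n} c c′ → Rep k A B j n c → Rep k A B j n c′ → ∀ i → i ≤ k → c i ≡ c′ i
  rep-unique {n} c c′ (n≡Σc , c-left , c-right) (n≡Σc′ , c′-left , c′-right) i i≤k =
    ℤP.i-j≡0⇒i≡j (c i) (c′ i) (Vanishing.vanish suitable j≤k (λ i → c i - c′ i) difference-sum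
      (λ i i<j → digit-difference (c-left i i<j) (c′-left i i<j))
      (λ i j<i i≤k → digit-difference (c-right i j<i i≤k) (c′-right i j<i i≤k)) i i≤k)
    where
    open ≡-Reasoning
    difference-sum : sumTo (λ i → (c i - c′ i) * G i) k ≡ 0ℤ
    difference-sum = begin
      sumTo (λ i → (c i - c′ i) * G i) k                      ≡⟨ combination-sub G c c′ k ⟩
      sumTo (λ i → c i * G i) k - sumTo (λ i → c′ i * G i) k ≡⟨ cong₂ _-_ (sym n≡Σc) (sym n≡Σc′) ⟩
      n - n                                                    ≡⟨ ℤP.+-inverseʳ n ⟩
      0ℤ                                                       ∎

  -- Normalising a natural-number combination yields a nonnegative j-th coefficient; by
  -- uniqueness, so does every representation of an element of S.
  member⇒nonneg : ∀ {n} c → Rep k A B j n c → InS k A B n → 0ℤ ≤ℤ c j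
  member⇒nonneg {n} c rep (x , n≡Σx) =
    subst (0ℤ ≤ℤ_) (rep-unique _ c (normal-rep d n≡Σd) rep j j≤k)
      (Normalise.normal-nonneg suitable j≤k d (λ i → +≤+ z≤n))
    where
    d : ℕ → ℤ
    d i = + x i
    n≡Σd : n ≡ sumTo (λ i → d i * G i) k
    n≡Σd = trans n≡Σx (sum-cong k λ i _ → ℤP.pos-* (x i) (g k A B i))

  nonneg⇒member : ∀ {n} c → Rep k A B j n c → 0ℤ ≤ℤ c j → InS k A B n
  nonneg⇒member c (n≡Σc , c-left , c-right) cⱼ≥0 = (λ i → ∣ c i ∣) , trans n≡Σc (sum-cong k term)
    where
    c≥0 : ∀ i → i ≤ k → 0ℤ ≤ℤ c i
    c≥0 i i≤k with ℕP.<-cmp i j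
    ... | tri< i<j _ _  = proj₁ (c-left i i<j)
    ... | tri≈ _ refl _ = cⱼ≥0
    ... | tri> _ _ j<i  = proj₁ (c-right i j<i i≤k)
    term : ∀ i → i ≤ k → c i * G i ≡ + (∣ c i ∣ ℕ.* g k A B i)
    term i i≤k = trans (cong (_* G i) (sym (ℤP.0≤i⇒+∣i∣≡i (c≥0 i i≤k)))) (sym (ℤP.pos-* ∣ c i ∣ (g k A B i)))

  member-iff : ∀ {n} c → Rep k A B j n c → InS k A B n ⇔ (0ℤ ≤ℤ c j)
  member-iff c rep = mk⇔ (member⇒nonneg c rep) (nonneg⇒member c rep)

  rep-shift : ∀ {n} c → Rep k A B j n c → Rep k A B j (n - G j) (λ i → c i - unit j i)
  rep-shift {n} c (n≡Σc , c-left , c-right) = n-Gⱼ≡Σ , shifted-left , shifted-right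
    where
    open ≡-Reasoning
    Σunit≡Gⱼ : sumTo (λ i → unit j i * G i) k ≡ G j
    Σunit≡Gⱼ = begin
      sumTo (λ i → unit j i * G i) k ≡⟨ sum-single (λ i → unit j i * G i) k j≤k (λ i _ i≢j → cong (_* G i) (unit-off i≢j)) ⟩
      unit j j * G j                 ≡⟨ cong (_* G j) (unit-on j) ⟩
      1ℤ * G j                       ≡⟨ ℤP.*-identityˡ (G j) ⟩
      G j                            ∎
    n-Gⱼ≡Σ : n - G j ≡ sumTo (λ i → (c i - unit j i) * G i) k
    n-Gⱼ≡Σ = sym (begin
      sumTo (λ i → (c i - unit j i) * G i) k                         ≡⟨ combination-sub G c (unit j) k ⟩
      sumTo (λ i → c i * G i) k - sumTo (λ i → unit j i * G i) k   ≡⟨ cong₂ _-_ (sym n≡Σc) Σunit≡Gⱼ ⟩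
      n - G j                                                        ∎)
    unchanged : ∀ {i} → i ≢ j → c i - unit j i ≡ c i
    unchanged {i} i≢j = trans (cong (λ u → c i - u) (unit-off i≢j)) (ℤP.+-identityʳ (c i))
    shifted-left : ∀ i → i < j → InRange (B (suc i)) (c i - unit j i)
    shifted-left i i<j = subst (InRange (B (suc i))) (sym (unchanged (ℕP.<⇒≢ i<j))) (c-left i i<j)
    shifted-right : ∀ i → j < i → i ≤ k → InRange (A i) (c i - unit j i)
    shifted-right i j<i i≤k = subst (InRange (A i)) (sym (unchanged (ℕP.>⇒≢ j<i))) (c-right i j<i i≤k)

  shift-member-iff : ∀ {n} c → Rep k A B j n c → InS k A B (n - G j) ⇔ (0ℤ ≤ℤ c j - 1ℤ)
  shift-member-iff {n} c rep =
    subst (λ u → InS k A B (n - G j) ⇔ (0ℤ ≤ℤ c j - u)) (unit-on j) (member-iff _ (rep-shift c rep))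

  apéry-iff : ∀ {n} c → Rep k A B j n c → InAp k A B j n ⇔ (c j ≡ 0ℤ)
  apéry-iff {n} c rep = mk⇔ digit-zero in-apéry
    where
    open Equivalence
    last-digit : ∀ {x} → 0ℤ ≤ℤ x → ¬ (0ℤ ≤ℤ x - 1ℤ) → x ≡ 0ℤ
    last-digit {+ zero}  _ _      = refl
    last-digit {+ suc m} _ x-1≱0 = contradiction (+≤+ z≤n) x-1≱0
    digit-zero : InAp k A B j n → c j ≡ 0ℤ
    digit-zero (n∈S , n-Gⱼ∉S) = last-digit (to (member-iff c rep) n∈S) (n-Gⱼ∉S ∘ from (shift-member-iff c rep))
    in-apéry : c j ≡ 0ℤ → InAp k A B j n
    in-apéry cⱼ≡0 = from (member-iff c rep) (subst (0ℤ ≤ℤ_) (sym cⱼ≡0) (+≤+ z≤n))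
                  , λ n-Gⱼ∈S → case subst (λ x → 0ℤ ≤ℤ x - 1ℤ) cⱼ≡0 (to (shift-member-iff c rep) n-Gⱼ∈S) of λ ()

corollary3p13 : (k : ℕ) (A B : ℕ → ℕ) → Suitable k A B →
    (j : ℕ) → j ≤ k → (n : ℤ) →
      (∃ λ c → Rep k A B j n c)
      × (∀ c c′ → Rep k A B j n c → Rep k A B j n c′ → ∀ i → i ≤ k → c i ≡ c′ i)
      × (∀ c → Rep k A B j n c →
           (InS k A B n ⇔ (+ 0 ≤ℤ c j)) × (InAp k A B j n ⇔ (c j ≡ + 0)))
corollary3p13 k A B suitable j j≤k n =
  rep-exists n , rep-unique , λ c rep → member-iff c rep , apéry-iff c rep
  where open Representation suitable j≤k
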